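{- Let $G$ be a connected graph and let $\{A_1,B_1\}$ and $\{A_2,B_2\}$ be crossing cut-separations of $G$ such that both $\{A_1\cap A_2,\ B_1\cup B_2\}$ and $\{A_1\cup A_2,\ B_1\cap B_2\}$ are cut-separations as well. Then every cut-separation of $G$ that crosses both $\{A_1\cap A_2, B_1\cup B_2\}$ and $\{A_1\cup A_2, B_1\cap B_2\}$ also crosses both $\{A_1,B_1\}$ and $\{A_2,B_2\}$.
   Context: A cut-separation of $G$ is a bipartition $\{A,B\}$ of $V(G)$ into two nonempty sets. Two cut-separations $\{A,B\}$ and $\{C,D\}$ are nested if one of $A\subseteq C$, $A\subseteq D$, $B\subseteq C$, $B\subseteq D$ holds; otherwise they cross. -}

module Defs where

open import Data.Nat using (ℕ)
open import Data.Fin using (Fin)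
open import Data.Fin.Subset using (Subset; _∈_; _∉_; _⊆_; Nonempty)
open import Data.Product using (_×_)
open import Data.Sum using (_⊎_)
open import Relation.Nullary using (¬_)
open import Level using (0ℓ)

record Graph : Set₁ where
  field
    n     : ℕ
    Adj   : Fin n → Fin n → Set
    sym   : ∀ {u v} → Adj u v → Adj v u
    irrefl : ∀ {u} → ¬ Adj u u

open Graph public

data Walk (G : Graph) : Fin (n G) → Fin (n G) → Set where
  [] : ∀ {u} → Walk G u u
  _∷_ : ∀ {u v w} → Adj G u v → Walk G v w → Walk G u w

Connected : Graph → Set
Connected G = ∀ (u v : Fin (n G)) → Walk G u v

IsCutSep : (G : Graph) → Subset (n G) → Subset (n G) → Set
IsCutSep G A B =
  (∀ v → v ∈ A ⊎ v ∈ B) × (∀ v → v ∈ A → v ∉ B) × Nonempty A × Nonempty B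

Nested : ∀ {m} → Subset m → Subset m → Subset m → Subset m → Set
Nested A B C D = A ⊆ C ⊎ A ⊆ D ⊎ B ⊆ C ⊎ B ⊆ D

Cross : ∀ {m} → Subset m → Subset m → Subset m → Subset m → Set
Cross A B C D = ¬ Nested A B C D

-- If {C, D} were nested with {A₁, B₁}, some side of {C, D} would lie in A₁ or in B₁,
-- hence in A₁ ∪ A₂ or in B₁ ∪ B₂, making {C, D} nested with one of the two corner
-- separations. The same works for {A₂, B₂}.
module Submission where

open import Defs
open import Data.Fin.Subset using (Subset; _⊆_; _∩_; _∪_)
open import Data.Fin.Subset.Properties using (⊆-trans; p⊆p∪q; q⊆p∪q)
open import Data.Product using (_×_; _,_)
open import Data.Sum using (_⊎_; inj₁; inj₂; [_,_])

nested-⊆-either : ∀ {m} {C D A B A′ B′ : Subset m} (A″ B″ : Subset m) →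
  A ⊆ A′ → B ⊆ B′ → Nested C D A B → Nested C D A′ B″ ⊎ Nested C D A″ B′
nested-⊆-either _ _ A⊆A′ _ (inj₁ C⊆A) =
  inj₁ (inj₁ (⊆-trans C⊆A A⊆A′))
nested-⊆-either _ _ _ B⊆B′ (inj₂ (inj₁ C⊆B)) =
  inj₂ (inj₂ (inj₁ (⊆-trans C⊆B B⊆B′)))
nested-⊆-either _ _ A⊆A′ _ (inj₂ (inj₂ (inj₁ D⊆A))) =
  inj₁ (inj₂ (inj₂ (inj₁ (⊆-trans D⊆A A⊆A′))))
nested-⊆-either _ _ _ B⊆B′ (inj₂ (inj₂ (inj₂ D⊆B))) =
  inj₂ (inj₂ (inj₂ (inj₂ (⊆-trans D⊆B B⊆B′))))

cross-if-cross-corners : ∀ {m} {C D A B A′ B′ A″ B″ : Subset m} →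
  A ⊆ A′ → B ⊆ B′ → Cross C D A′ B″ → Cross C D A″ B′ → Cross C D A B
cross-if-cross-corners {A″ = A″} {B″} A⊆A′ B⊆B′ cross′ cross″ nested =
  [ cross′ , cross″ ] (nested-⊆-either A″ B″ A⊆A′ B⊆B′ nested)

lemma3p4 : (G : Graph) → Connected G →
    (A₁ B₁ A₂ B₂ : Subset (n G)) →
    IsCutSep G A₁ B₁ → IsCutSep G A₂ B₂ → Cross A₁ B₁ A₂ B₂ →
    IsCutSep G (A₁ ∩ A₂) (B₁ ∪ B₂) → IsCutSep G (A₁ ∪ A₂) (B₁ ∩ B₂) →
    (C D : Subset (n G)) → IsCutSep G C D →
    Cross C D (A₁ ∩ A₂) (B₁ ∪ B₂) → Cross C D (A₁ ∪ A₂) (B₁ ∩ B₂) →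
    Cross C D A₁ B₁ × Cross C D A₂ B₂
lemma3p4 G _ A₁ B₁ A₂ B₂ _ _ _ _ _ C D _ cross-∩ cross-∪ =
    cross-if-cross-corners (p⊆p∪q A₂) (p⊆p∪q B₂) cross-∪ cross-∩
  , cross-if-cross-corners (q⊆p∪q A₁ A₂) (q⊆p∪q B₁ B₂) cross-∪ cross-∩
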